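{- Let $\mathcal N$ be the punctured Nordstrom–Robinson code of length $15$ (containing the zero vector), and let $\mathcal H_{15}$ be its linear span, which is a binary Hamming code of length $15$. Then $\mathrm{Aut}(\mathcal N)$ is narrow-sense embedded in $\mathrm{Aut}(\mathcal H_{15})$, i.e. $\mathrm{Aut}(\mathcal N)\leq \mathrm{Aut}(\mathcal H_{15})$ and $\Pi_{\mathrm{Aut}(\mathcal N)}=\Pi_{\mathrm{Aut}(\mathcal H_{15})}$.
   Context: The punctured Nordstrom–Robinson code $\mathcal N$ is the nonlinear binary code of length $15$, size $2^8$ and minimum distance $5$ obtained by deleting one coordinate of the (extended) Nordstrom–Robinson code of length $16$; its linear span is the Hamming code of length $15$. For $\pi\in S_n$ and $y\in F_2^n$, $\pi(y)$ permutes coordinates of $y$; a pair $(x,\pi)$ acts on $F_2^n$ by $y\mapsto x+\pi(y)$. For a code $C\subseteq F_2^n$ containing $0^n$, $\mathrm{Aut}(C)=\{(x,\pi): x\in C,\ \pi\in S_n,\ x+\pi(C)=C\}$, a group under composition. For a group $G$ of such pairs, $\Pi_G=\{\pi: (x,\pi)\in G \text{ for some } x\}\leq S_n$. A group $H$ is narrow-sense embedded in $G$ if $H\leq G$ and $\Pi_G=\Pi_H$. -}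

module Defs where

open import Data.Bool using (Bool; true; false; _xor_; _∧_)
open import Data.Nat using (ℕ)
open import Data.Fin as Fin using (Fin)
open import Data.Fin.Permutation using (Permutation′; _⟨$⟩ʳ_; _⟨$⟩ˡ_)
open import Data.Vec using (Vec; []; _∷_; tabulate; lookup; zipWith; replicate; foldr)
open import Data.List as List using (List; []; _∷_; concatMap)
open import Data.List.Membership.Propositional using (_∈_)
open import Data.List.Relation.Unary.All using (All)
open import Data.Product using (Σ; ∃; _×_; _,_)
open import Relation.Binary.PropositionalEquality using (_≡_)

Word : ℕ → Set
Word n = Vec Bool n

_⊕_ : ∀ {n} → Word n → Word n → Word n
_⊕_ = zipWith _xor_

0ʷ : ∀ {n} → Word n
0ʷ = replicate _ false

-- π(y): coordinate i of y is moved to position π(i),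
-- i.e. π(y)_j = y_{π⁻¹(j)}.
permute : ∀ {n} → Permutation′ n → Word n → Word n
permute π y = tabulate (λ j → lookup y (π ⟨$⟩ˡ j))

Code : ℕ → Set
Code n = List (Word n)

_∈Span_ : ∀ {n} → Word n → Code n → Set
y ∈Span C = Σ (List (Word _)) λ ws → All (_∈ C) ws × List.foldr _⊕_ 0ʷ ws ≡ y

TranslatesOnto : ∀ {n} → (Word n → Set) → Word n → Permutation′ n → Set
TranslatesOnto {n} C x π =
  (∀ (y : Word n) → C y → C (x ⊕ permute π y)) ×
  (∀ (z : Word n) → C z → Σ (Word n) λ y → C y × z ≡ x ⊕ permute π y)

InAut : ∀ {n} → (Word n → Set) → Word n → Permutation′ n → Set
InAut C x π = C x × TranslatesOnto C x π

InΠAut : ∀ {n} → (Word n → Set) → Permutation′ n → Set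
InΠAut {n} C π = Σ (Word n) λ x → InAut C x π

-- Aut(C) is narrow-sense embedded in Aut(D):
-- Aut(C) ≤ Aut(D) (both are sets of pairs (x,π) with the same composition,
-- so being a subgroup is being a subset) and Π_{Aut(C)} = Π_{Aut(D)}.
NarrowSenseEmbedded : ∀ {n} → (Word n → Set) → (Word n → Set) → Set
NarrowSenseEmbedded {n} C D =
  (∀ (x : Word n) (π : Permutation′ n) → InAut C x π → InAut D x π) ×
  (∀ (π : Permutation′ n) → InΠAut C π → InΠAut D π) ×
  (∀ (π : Permutation′ n) → InΠAut D π → InΠAut C π)

-- The Nordstrom–Robinson code via the Kerdock construction (m = 4).
-- Coordinates of the length-16 code are the points v = (v₀,v₁,v₂,v₃) of F₂⁴;
-- codewords are the evaluations of  Q(v) + a·v + b  where Q ranges over a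
-- Kerdock set of 8 quadratic forms (pairwise sums have nondegenerate
-- associated alternating form) and a ∈ F₂⁴, b ∈ F₂.
-- Puncturing deletes the coordinate v = 0.

Pt : Set
Pt = Vec Bool 4

allPts : List Pt
allPts = concatMap (λ a → concatMap (λ b → concatMap (λ c → List.map (λ d → a ∷ b ∷ c ∷ d ∷ []) (false ∷ true ∷ [])) (false ∷ true ∷ [])) (false ∷ true ∷ [])) (false ∷ true ∷ [])

nonzeroPts : Vec Pt 15
nonzeroPts =
  p 0 0 0 1 ∷ p 0 0 1 0 ∷ p 0 0 1 1 ∷ p 0 1 0 0 ∷ p 0 1 0 1 ∷
  p 0 1 1 0 ∷ p 0 1 1 1 ∷ p 1 0 0 0 ∷ p 1 0 0 1 ∷ p 1 0 1 0 ∷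
  p 1 0 1 1 ∷ p 1 1 0 0 ∷ p 1 1 0 1 ∷ p 1 1 1 0 ∷ p 1 1 1 1 ∷ []
  where
  b : ℕ → Bool
  b ℕ.zero = false
  b (ℕ.suc _) = true
  p : ℕ → ℕ → ℕ → ℕ → Pt
  p w x y z = b w ∷ b x ∷ b y ∷ b z ∷ []

dot : Pt → Pt → Bool
dot u v = foldr _ _xor_ false (zipWith _∧_ u v)

Quad : Set
Quad = List (Fin 4 × Fin 4)

evalQ : Quad → Pt → Bool
evalQ S v = List.foldr (λ { (i , j) r → (lookup v i ∧ lookup v j) xor r }) false S

x0 x1 x2 x3 : Fin 4
x0 = Fin.zero
x1 = Fin.suc Fin.zero
x2 = Fin.suc (Fin.suc Fin.zero)
x3 = Fin.suc (Fin.suc (Fin.suc Fin.zero))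

kerdockSet : List Quad
kerdockSet =
  [] ∷
  ((x0 , x1) ∷ (x2 , x3) ∷ []) ∷
  ((x0 , x1) ∷ (x0 , x2) ∷ (x1 , x3) ∷ []) ∷
  ((x0 , x3) ∷ (x1 , x2) ∷ (x2 , x3) ∷ []) ∷
  ((x0 , x1) ∷ (x0 , x2) ∷ (x0 , x3) ∷ (x1 , x2) ∷ []) ∷
  ((x0 , x1) ∷ (x0 , x3) ∷ (x1 , x2) ∷ (x1 , x3) ∷ []) ∷
  ((x0 , x2) ∷ (x0 , x3) ∷ (x1 , x3) ∷ (x2 , x3) ∷ []) ∷
  ((x0 , x2) ∷ (x1 , x2) ∷ (x1 , x3) ∷ (x2 , x3) ∷ []) ∷ []

puncturedNR : Code 15
puncturedNR =
  concatMap (λ S → concatMap (λ a → List.map (λ c →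
      Data.Vec.map (λ v → (evalQ S v xor dot a v) xor c) nonzeroPts)
    (false ∷ true ∷ [])) allPts) kerdockSet

𝒩 : Word 15 → Set
𝒩 y = y ∈ puncturedNR

ℋ₁₅ : Word 15 → Set
ℋ₁₅ y = y ∈Span puncturedNR

-- The 15 coordinates are the points of PG(3,2).  The proof has two halves.
-- (1) Aut(C) ≤ Aut(span C) for every code C ∋ 0ʷ: the map y ↦ x + π(y) is
--     affine, so it carries span C onto span C when it carries C onto C
--     (aut-span).  This also gives Π_{Aut 𝒩} ⊆ Π_{Aut ℋ₁₅}.
-- (2) Conversely let π be the permutation part of an automorphism of ℋ₁₅.
--     As ℋ₁₅ lies in the kernel of the syndrome map and contains every line
--     word, π maps lines to lines, i.e. it is linear (preserving⇒linear).
--     Every linear permutation is liftable for 𝒩 (a translate of its image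
--     of 𝒩 lies in 𝒩): a stabiliser chain of GL(4,2) along a basis reduces
--     this to finitely many words in two liftable generators
--     (linear⇒liftable).  Liftability of π and π⁻¹ yields an automorphism of
--     𝒩 with permutation part π (liftable⇒InΠAut).

module Submission where

open import Defs
open import Data.Bool using (Bool; true; false; _xor_; _∧_; not; T; if_then_else_)
open import Data.Bool.ListAction using (all; any)
open import Data.Bool.Properties using (T-≡; xor-assoc; xor-comm; xor-identityˡ; xor-identityʳ; xor-same) renaming (_≟_ to _≟ᵇ_)
open import Data.Nat using (ℕ)
open import Data.Fin as Fin using (Fin; _≟_; #_)
open import Data.Fin.Properties using (all?)
open import Data.Fin.Permutation using (Permutation′; _⟨$⟩ʳ_; _⟨$⟩ˡ_; inverseˡ; inverseʳ)
open import Data.Vec as Vec using (Vec; []; _∷_; tabulate; lookup)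
open import Data.Vec.Properties using (≡-dec; zipWith-assoc; zipWith-comm; zipWith-identityˡ; zipWith-identityʳ; tabulate-cong; tabulate∘lookup; lookup∘tabulate; lookup-zipWith; lookup-replicate)
open import Data.List as List using (List; []; _∷_; _++_)
open import Data.List.Membership.Propositional using (_∈_)
open import Data.List.Membership.Propositional.Properties using (∈-++⁻; ∈-map⁻; ∈-map⁺; ∈-concat⁺′; ∈-lookup)
open import Data.List.Membership.DecPropositional (_≟_ {15}) using (_∈?_)
open import Data.List.Relation.Unary.All as All using (All; []; _∷_)
open import Data.List.Relation.Unary.Any as Any using (Any; any?; here; there)
open import Data.List.Relation.Unary.All.Properties using (++⁺; all⁺)
open import Data.List.Relation.Unary.Any.Properties using (any⁻)
open import Data.Product using (Σ; _×_; _,_; proj₁; proj₂)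
open import Data.Sum using (inj₁; inj₂)
open import Function.Bundles using (mk⇔; Equivalence)
open import Function.Definitions using (Injective)
open import Relation.Nullary using (¬_; ¬?; does; Dec)
open import Relation.Nullary.Decidable using (True; toWitness; does-⇔; from-yes; _×-dec_; _→-dec_)
open import Relation.Binary.PropositionalEquality

private
  variable
    n : ℕ

⊕-assoc : (u v w : Word n) → (u ⊕ v) ⊕ w ≡ u ⊕ (v ⊕ w)
⊕-assoc = zipWith-assoc xor-assoc

⊕-comm : (u v : Word n) → u ⊕ v ≡ v ⊕ u
⊕-comm = zipWith-comm xor-comm

⊕-identityˡ : (u : Word n) → 0ʷ ⊕ u ≡ u
⊕-identityˡ = zipWith-identityˡ xor-identityˡ

⊕-identityʳ : (u : Word n) → u ⊕ 0ʷ ≡ u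
⊕-identityʳ = zipWith-identityʳ xor-identityʳ

⊕-self : (u : Word n) → u ⊕ u ≡ 0ʷ
⊕-self []      = refl
⊕-self (a ∷ u) = cong₂ _∷_ (xor-same a) (⊕-self u)

⊕-cancelˡ : (u v : Word n) → u ⊕ (u ⊕ v) ≡ v
⊕-cancelˡ u v = begin
  u ⊕ (u ⊕ v)  ≡⟨ ⊕-assoc u u v ⟨
  (u ⊕ u) ⊕ v  ≡⟨ cong (_⊕ v) (⊕-self u) ⟩
  0ʷ ⊕ v       ≡⟨ ⊕-identityˡ v ⟩
  v            ∎
  where open ≡-Reasoning

⊕-cancel-common : (x u v : Word n) → (x ⊕ u) ⊕ (x ⊕ v) ≡ u ⊕ v
⊕-cancel-common x u v = begin
  (x ⊕ u) ⊕ (x ⊕ v)  ≡⟨ ⊕-assoc x u (x ⊕ v) ⟩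
  x ⊕ (u ⊕ (x ⊕ v))  ≡⟨ cong (x ⊕_) (⊕-assoc u x v) ⟨
  x ⊕ ((u ⊕ x) ⊕ v)  ≡⟨ cong (λ w → x ⊕ (w ⊕ v)) (⊕-comm u x) ⟩
  x ⊕ ((x ⊕ u) ⊕ v)  ≡⟨ cong (x ⊕_) (⊕-assoc x u v) ⟩
  x ⊕ (x ⊕ (u ⊕ v))  ≡⟨ ⊕-cancelˡ x (u ⊕ v) ⟩
  u ⊕ v              ∎
  where open ≡-Reasoning

⊕-interchange : (a b c d : Word n) → (a ⊕ b) ⊕ (c ⊕ d) ≡ (a ⊕ c) ⊕ (b ⊕ d)
⊕-interchange a b c d = begin
  (a ⊕ b) ⊕ (c ⊕ d)  ≡⟨ ⊕-assoc a b (c ⊕ d) ⟩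
  a ⊕ (b ⊕ (c ⊕ d))  ≡⟨ cong (a ⊕_) (⊕-assoc b c d) ⟨
  a ⊕ ((b ⊕ c) ⊕ d)  ≡⟨ cong (λ w → a ⊕ (w ⊕ d)) (⊕-comm b c) ⟩
  a ⊕ ((c ⊕ b) ⊕ d)  ≡⟨ cong (a ⊕_) (⊕-assoc c b d) ⟩
  a ⊕ (c ⊕ (b ⊕ d))  ≡⟨ ⊕-assoc a c (b ⊕ d) ⟨
  (a ⊕ c) ⊕ (b ⊕ d)  ∎
  where open ≡-Reasoning

word-ext : {u v : Word n} → (∀ i → lookup u i ≡ lookup v i) → u ≡ v
word-ext {u = u} {v} eq = begin
  u                    ≡⟨ tabulate∘lookup u ⟨
  tabulate (lookup u)  ≡⟨ tabulate-cong eq ⟩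
  tabulate (lookup v)  ≡⟨ tabulate∘lookup v ⟩
  v                    ∎
  where open ≡-Reasoning

⊕-solve : (a b c : Word n) → a ⊕ (b ⊕ c) ≡ 0ʷ → c ≡ a ⊕ b
⊕-solve a b c sum≡0 = begin
  c                        ≡⟨ ⊕-cancelˡ (a ⊕ b) c ⟨
  (a ⊕ b) ⊕ ((a ⊕ b) ⊕ c)  ≡⟨ cong ((a ⊕ b) ⊕_) (trans (⊕-assoc a b c) sum≡0) ⟩
  (a ⊕ b) ⊕ 0ʷ             ≡⟨ ⊕-identityʳ (a ⊕ b) ⟩
  a ⊕ b                    ∎
  where open ≡-Reasoning

-- Relabelling coordinates by a map f : position j of  P f y  is  y (f j).
-- For a permutation π, Defs' permute π is definitionally  P (π ⟨$⟩ˡ_).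

P : (Fin n → Fin n) → Word n → Word n
P f y = tabulate (λ j → lookup y (f j))

lookup-P : (f : Fin n → Fin n) (y : Word n) (j : Fin n) → lookup (P f y) j ≡ lookup y (f j)
lookup-P f y = lookup∘tabulate (λ j → lookup y (f j))

P-⊕ : (f : Fin n → Fin n) (u v : Word n) → P f (u ⊕ v) ≡ P f u ⊕ P f v
P-⊕ f u v = word-ext λ j → begin
  lookup (P f (u ⊕ v)) j                ≡⟨ lookup-P f (u ⊕ v) j ⟩
  lookup (u ⊕ v) (f j)                  ≡⟨ lookup-zipWith _xor_ (f j) u v ⟩
  lookup u (f j) xor lookup v (f j)     ≡⟨ cong₂ _xor_ (lookup-P f u j) (lookup-P f v j) ⟨
  lookup (P f u) j xor lookup (P f v) j ≡⟨ lookup-zipWith _xor_ j (P f u) (P f v) ⟨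
  lookup (P f u ⊕ P f v) j              ∎
  where open ≡-Reasoning

P-0ʷ : (f : Fin n → Fin n) → P f 0ʷ ≡ 0ʷ
P-0ʷ f = word-ext λ j → begin
  lookup (P f 0ʷ) j  ≡⟨ lookup-P f 0ʷ j ⟩
  lookup 0ʷ (f j)    ≡⟨ lookup-replicate (f j) false ⟩
  false              ≡⟨ lookup-replicate j false ⟨
  lookup 0ʷ j        ∎
  where open ≡-Reasoning

P-∘ : (f h : Fin n → Fin n) (y : Word n) → P (λ j → f (h j)) y ≡ P h (P f y)
P-∘ f h y = tabulate-cong λ j → sym (lookup-P f y (h j))

P-cong : {f f′ : Fin n → Fin n} → (∀ j → f j ≡ f′ j) → (y : Word n) → P f y ≡ P f′ y
P-cong eq y = tabulate-cong λ j → cong (lookup y) (eq j)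

P-id : (y : Word n) → P (λ j → j) y ≡ y
P-id = tabulate∘lookup

Liftable : (Word n → Set) → (Fin n → Fin n) → Set
Liftable {n} C f = Σ (Word n) λ x → ∀ y → C y → C (x ⊕ P f y)

liftable-id : (C : Word n → Set) → Liftable C (λ j → j)
liftable-id C = 0ʷ , λ y Cy → subst C (sym (trans (⊕-identityˡ (P (λ j → j) y)) (P-id y))) Cy

liftable-∘ : (C : Word n → Set) {f h : Fin n → Fin n} →
             Liftable C f → Liftable C h → Liftable C (λ j → f (h j))
liftable-∘ C {f} {h} (x , liftf) (z , lifth) =
  z ⊕ P h x , λ y Cy → subst C (translate y) (lifth (x ⊕ P f y) (liftf y Cy))
  where
  open ≡-Reasoning
  translate : ∀ y → z ⊕ P h (x ⊕ P f y) ≡ (z ⊕ P h x) ⊕ P (λ j → f (h j)) y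
  translate y = begin
    z ⊕ P h (x ⊕ P f y)          ≡⟨ cong (z ⊕_) (P-⊕ h x (P f y)) ⟩
    z ⊕ (P h x ⊕ P h (P f y))    ≡⟨ ⊕-assoc z (P h x) (P h (P f y)) ⟨
    (z ⊕ P h x) ⊕ P h (P f y)    ≡⟨ cong ((z ⊕ P h x) ⊕_) (P-∘ f h y) ⟨
    (z ⊕ P h x) ⊕ P (λ j → f (h j)) y ∎

liftable-cong : (C : Word n → Set) {f f′ : Fin n → Fin n} →
                (∀ j → f j ≡ f′ j) → Liftable C f → Liftable C f′
liftable-cong C eq (x , lift) = x , λ y Cy → subst (λ w → C (x ⊕ w)) (P-cong eq y) (lift y Cy)

-- If a code contains 0ʷ and both π and π⁻¹ are liftable, then π is the
-- permutation part of an automorphism: the two lifts compose to a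
-- translation t ⊕ _ preserving C, which makes x ⊕ π(C) ⊆ C an equality.
liftable⇒InΠAut : (C : Word n → Set) (π : Permutation′ n) → C 0ʷ →
                  Liftable C (π ⟨$⟩ˡ_) → Liftable C (π ⟨$⟩ʳ_) → InΠAut C π
liftable⇒InΠAut {n} C π C0 (x , liftˡ) (z , liftʳ) = x , C-x , liftˡ , onto
  where
  open ≡-Reasoning
  C-x : C x
  C-x = subst C (trans (cong (x ⊕_) (P-0ʷ (π ⟨$⟩ˡ_))) (⊕-identityʳ x)) (liftˡ 0ʷ C0)
  t : Word n
  t = x ⊕ P (π ⟨$⟩ˡ_) z
  round-trip : ∀ w → x ⊕ P (π ⟨$⟩ˡ_) (z ⊕ P (π ⟨$⟩ʳ_) w) ≡ t ⊕ w
  round-trip w = begin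
    x ⊕ P (π ⟨$⟩ˡ_) (z ⊕ P (π ⟨$⟩ʳ_) w)
      ≡⟨ cong (x ⊕_) (P-⊕ (π ⟨$⟩ˡ_) z (P (π ⟨$⟩ʳ_) w)) ⟩
    x ⊕ (P (π ⟨$⟩ˡ_) z ⊕ P (π ⟨$⟩ˡ_) (P (π ⟨$⟩ʳ_) w))
      ≡⟨ cong (λ v → x ⊕ (P (π ⟨$⟩ˡ_) z ⊕ v)) (P-∘ (π ⟨$⟩ʳ_) (π ⟨$⟩ˡ_) w) ⟨
    x ⊕ (P (π ⟨$⟩ˡ_) z ⊕ P (λ j → π ⟨$⟩ʳ (π ⟨$⟩ˡ j)) w)
      ≡⟨ cong (λ v → x ⊕ (P (π ⟨$⟩ˡ_) z ⊕ v)) (trans (P-cong (λ j → inverseʳ π) w) (P-id w)) ⟩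
    x ⊕ (P (π ⟨$⟩ˡ_) z ⊕ w)
      ≡⟨ ⊕-assoc x (P (π ⟨$⟩ˡ_) z) w ⟨
    t ⊕ w ∎
  C-t⊕ : ∀ w → C w → C (t ⊕ w)
  C-t⊕ w Cw = subst C (round-trip w) (liftˡ _ (liftʳ w Cw))
  onto : ∀ w → C w → Σ (Word n) λ y → C y × w ≡ x ⊕ P (π ⟨$⟩ˡ_) y
  onto w Cw = z ⊕ P (π ⟨$⟩ʳ_) (t ⊕ w) , liftʳ (t ⊕ w) (C-t⊕ w Cw) ,
              sym (trans (round-trip (t ⊕ w)) (⊕-cancelˡ t w))

sumʷ : List (Word n) → Word n
sumʷ = List.foldr _⊕_ 0ʷ

span-∈ : {C : Code n} {y : Word n} → y ∈ C → y ∈Span C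
span-∈ {y = y} y∈C = y ∷ [] , y∈C ∷ [] , ⊕-identityʳ y

sumʷ-++ : (us vs : List (Word n)) → sumʷ (us ++ vs) ≡ sumʷ us ⊕ sumʷ vs
sumʷ-++ []       vs = sym (⊕-identityˡ (sumʷ vs))
sumʷ-++ (u ∷ us) vs = trans (cong (u ⊕_) (sumʷ-++ us vs)) (sym (⊕-assoc u (sumʷ us) (sumʷ vs)))

span-⊕ : {C : Code n} {u v : Word n} → u ∈Span C → v ∈Span C → (u ⊕ v) ∈Span C
span-⊕ (us , us∈C , refl) (vs , vs∈C , refl) = us ++ vs , ++⁺ us∈C vs∈C , sumʷ-++ us vs

-- Over F₂ a map is affine iff it preserves sums of three vectors.
Affine : (Word n → Word n) → Set
Affine {n} φ = (a b c : Word n) → φ (a ⊕ (b ⊕ c)) ≡ φ a ⊕ (φ b ⊕ φ c)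

translate-affine : (x : Word n) (f : Fin n → Fin n) → Affine (λ y → x ⊕ P f y)
translate-affine x f a b c = begin
  x ⊕ P f (a ⊕ (b ⊕ c))                    ≡⟨ cong (x ⊕_) (trans (P-⊕ f a (b ⊕ c)) (cong (P f a ⊕_) (P-⊕ f b c))) ⟩
  x ⊕ (P f a ⊕ (P f b ⊕ P f c))            ≡⟨ ⊕-assoc x (P f a) (P f b ⊕ P f c) ⟨
  (x ⊕ P f a) ⊕ (P f b ⊕ P f c)            ≡⟨ cong ((x ⊕ P f a) ⊕_) (⊕-cancel-common x (P f b) (P f c)) ⟨
  (x ⊕ P f a) ⊕ ((x ⊕ P f b) ⊕ (x ⊕ P f c)) ∎
  where open ≡-Reasoning

-- The image of a span under an affine map φ lies in span D as soon as the
-- generators and 0ʷ are mapped there, since φ (w ⊕ s) = φ w ⊕ φ s ⊕ φ 0ʷ.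
affine-image-span : {C D : Code n} (φ : Word n → Word n) → Affine φ →
                    (∀ y → y ∈ C → φ y ∈Span D) → φ 0ʷ ∈Span D →
                    ∀ y → y ∈Span C → φ y ∈Span D
affine-image-span {C = C} {D} φ affine gens zero y (ws , ws∈C , refl) = image ws ws∈C
  where
  image : ∀ ws → All (_∈ C) ws → φ (sumʷ ws) ∈Span D
  image []       []           = zero
  image (w ∷ ws) (w∈C ∷ ws∈C) =
    subst (λ v → v ∈Span D)
          (trans (sym (affine w (sumʷ ws) 0ʷ)) (cong (λ s → φ (w ⊕ s)) (⊕-identityʳ (sumʷ ws))))
          (span-⊕ (gens w w∈C) (span-⊕ (image ws ws∈C) zero))

affine-preimage-span : {C D : Code n} (φ : Word n → Word n) → Affine φ →
                       (∀ z → z ∈ C → Σ (Word n) λ y → y ∈Span D × z ≡ φ y) →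
                       Σ (Word n) (λ y → y ∈Span D × 0ʷ ≡ φ y) →
                       ∀ z → z ∈Span C → Σ (Word n) λ y → y ∈Span D × z ≡ φ y
affine-preimage-span {n} {C} {D} φ affine gens (y₀ , y₀∈D , φy₀) z (zs , zs∈C , refl) = preimage zs zs∈C
  where
  preimage : ∀ zs → All (_∈ C) zs → Σ (Word n) λ y → y ∈Span D × sumʷ zs ≡ φ y
  preimage []       []           = y₀ , y₀∈D , φy₀
  preimage (z ∷ zs) (z∈C ∷ zs∈C) with gens z z∈C | preimage zs zs∈C
  ... | y , y∈D , refl | ys , ys∈D , sum≡ =
    y ⊕ (ys ⊕ y₀) , span-⊕ y∈D (span-⊕ ys∈D y₀∈D) , sum≡φ
    where
    open ≡-Reasoning
    sum≡φ : φ y ⊕ sumʷ zs ≡ φ (y ⊕ (ys ⊕ y₀))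
    sum≡φ = begin
      φ y ⊕ sumʷ zs         ≡⟨ cong (φ y ⊕_) (trans sum≡ (sym (⊕-identityʳ (φ ys)))) ⟩
      φ y ⊕ (φ ys ⊕ 0ʷ)     ≡⟨ cong (λ o → φ y ⊕ (φ ys ⊕ o)) φy₀ ⟩
      φ y ⊕ (φ ys ⊕ φ y₀)   ≡⟨ affine y ys y₀ ⟨
      φ (y ⊕ (ys ⊕ y₀))     ∎

aut-span : (C : Code n) → 0ʷ ∈ C → ∀ x π → InAut (_∈ C) x π → InAut (_∈Span C) x π
aut-span {n} C 0∈C x π (x∈C , forth , back) =
  span-∈ x∈C ,
  affine-image-span φ φ-affine (λ y y∈C → span-∈ (forth y y∈C)) (span-∈ (subst (_∈ C) (sym φ0) x∈C)) ,
  affine-preimage-span φ φ-affine (λ z z∈C → lift-back (back z z∈C)) (lift-back (back 0ʷ 0∈C))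
  where
  φ : Word n → Word n
  φ y = x ⊕ permute π y
  φ-affine : Affine φ
  φ-affine = translate-affine x (π ⟨$⟩ˡ_)
  φ0 : φ 0ʷ ≡ x
  φ0 = trans (cong (x ⊕_) (P-0ʷ (π ⟨$⟩ˡ_))) (⊕-identityʳ x)
  lift-back : ∀ {z} → Σ (Word n) (λ y → y ∈ C × z ≡ φ y) → Σ (Word n) λ y → y ∈Span C × z ≡ φ y
  lift-back (y , y∈C , eq) = y , span-∈ y∈C , eq

-- The 15 coordinates are the points of PG(3,2): position i carries the
-- nonzero vector  pt i  of F₂⁴ (Defs' nonzeroPts), and  idx  is its inverse.

Pos : Set
Pos = Fin 15

pt : Pos → Pt
pt i = lookup nonzeroPts i

idx : Pt → Pos
idx (false ∷ false ∷ false ∷ false ∷ []) = Fin.zero   -- 0 is not a point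
idx (false ∷ false ∷ false ∷ true  ∷ []) = # 0
idx (false ∷ false ∷ true  ∷ false ∷ []) = # 1
idx (false ∷ false ∷ true  ∷ true  ∷ []) = # 2
idx (false ∷ true  ∷ false ∷ false ∷ []) = # 3
idx (false ∷ true  ∷ false ∷ true  ∷ []) = # 4
idx (false ∷ true  ∷ true  ∷ false ∷ []) = # 5
idx (false ∷ true  ∷ true  ∷ true  ∷ []) = # 6
idx (true  ∷ false ∷ false ∷ false ∷ []) = # 7
idx (true  ∷ false ∷ false ∷ true  ∷ []) = # 8
idx (true  ∷ false ∷ true  ∷ false ∷ []) = # 9
idx (true  ∷ false ∷ true  ∷ true  ∷ []) = # 10
idx (true  ∷ true  ∷ false ∷ false ∷ []) = # 11
idx (true  ∷ true  ∷ false ∷ true  ∷ []) = # 12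
idx (true  ∷ true  ∷ true  ∷ false ∷ []) = # 13
idx (true  ∷ true  ∷ true  ∷ true  ∷ []) = # 14

idx∘pt : ∀ i → idx (pt i) ≡ i
idx∘pt = from-yes (all? λ i → idx (pt i) ≟ i)

retraction⇒injective : {A : Set} {f g : A → A} → (∀ i → g (f i) ≡ i) → Injective _≡_ _≡_ f
retraction⇒injective {f = f} {g} gf {i} {j} fi≡fj = trans (sym (gf i)) (trans (cong g fi≡fj) (gf j))

-- The third point on the line through two distinct points.
_⊞_ : Pos → Pos → Pos
i ⊞ j = idx (pt i ⊕ pt j)

Linear : (Pos → Pos) → Set
Linear f = ∀ i j → ¬ i ≡ j → f (i ⊞ j) ≡ f i ⊞ f j

linear-∘ : {h f : Pos → Pos} → Linear h → Linear f → Injective _≡_ _≡_ f → Linear (λ i → h (f i))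
linear-∘ {h} {f} lin-h lin-f inj-f i j i≢j =
  trans (cong h (lin-f i j i≢j)) (lin-h (f i) (f j) (λ fi≡fj → i≢j (inj-f fi≡fj)))

linear-inverse : {g f : Pos → Pos} → (∀ i → f (g i) ≡ i) → (∀ j → g (f j) ≡ j) → Linear g → Linear f
linear-inverse {g} {f} fg gf lin-g i j i≢j = begin
  f (i ⊞ j)                  ≡⟨ cong (λ k → f (k ⊞ j)) (gf i) ⟨
  f (g (f i) ⊞ j)            ≡⟨ cong (λ k → f (g (f i) ⊞ k)) (gf j) ⟨
  f (g (f i) ⊞ g (f j))      ≡⟨ cong f (lin-g (f i) (f j) fi≢fj) ⟨
  f (g (f i ⊞ f j))          ≡⟨ fg (f i ⊞ f j) ⟩
  f i ⊞ f j                  ∎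
  where
  open ≡-Reasoning
  fi≢fj : ¬ f i ≡ f j
  fi≢fj fi≡fj = i≢j (trans (sym (gf i)) (trans (cong g fi≡fj) (gf j)))

syndrome : {m : ℕ} → Vec (Word m) n → Word n → Word m
syndrome []       []      = 0ʷ
syndrome (h ∷ hs) (b ∷ y) = (if b then h else 0ʷ) ⊕ syndrome hs y

select-xor : {m : ℕ} (a b : Bool) (h : Word m) →
             (if a xor b then h else 0ʷ) ≡ (if a then h else 0ʷ) ⊕ (if b then h else 0ʷ)
select-xor true  true  h = sym (⊕-self h)
select-xor true  false h = sym (⊕-identityʳ h)
select-xor false true  h = sym (⊕-identityˡ h)
select-xor false false h = sym (⊕-identityˡ 0ʷ)

syndrome-⊕ : {m : ℕ} (H : Vec (Word m) n) (u v : Word n) →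
             syndrome H (u ⊕ v) ≡ syndrome H u ⊕ syndrome H v
syndrome-⊕ []       []      []      = sym (⊕-identityˡ 0ʷ)
syndrome-⊕ (h ∷ hs) (a ∷ u) (b ∷ v) =
  trans (cong₂ _⊕_ (select-xor a b h) (syndrome-⊕ hs u v))
        (⊕-interchange (if a then h else 0ʷ) (if b then h else 0ʷ) (syndrome hs u) (syndrome hs v))

syndrome-span : {m : ℕ} (H : Vec (Word m) n) {C : Code n} →
                (∀ c → c ∈ C → syndrome H c ≡ 0ʷ) → ∀ y → y ∈Span C → syndrome H y ≡ 0ʷ
syndrome-span H {C} C⊆ker y (ws , ws∈C , refl) = sum-in-kernel ws ws∈C
  where
  sum-in-kernel : ∀ ws → All (_∈ C) ws → syndrome H (sumʷ ws) ≡ 0ʷ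
  sum-in-kernel []       []           = syndrome-span-0 H
    where
    syndrome-span-0 : {k m : ℕ} (H : Vec (Word m) k) → syndrome H 0ʷ ≡ 0ʷ
    syndrome-span-0 []       = refl
    syndrome-span-0 (h ∷ hs) = trans (⊕-identityˡ (syndrome hs 0ʷ)) (syndrome-span-0 hs)
  sum-in-kernel (w ∷ ws) (w∈C ∷ ws∈C) =
    trans (syndrome-⊕ H w (sumʷ ws))
          (trans (cong₂ _⊕_ (C⊆ker w w∈C) (sum-in-kernel ws ws∈C)) (⊕-identityˡ 0ʷ))

unit : Pos → Word 15
unit a = tabulate (λ j → does (j ≟ a))

triple : Pos → Pos → Pos → Word 15
triple a b c = unit a ⊕ (unit b ⊕ unit c)

line : Pos → Pos → Word 15
line i j = triple i j (i ⊞ j)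

-- The columns  pt j  form the parity-check matrix of the Hamming code.
syndrome-unit : ∀ a → syndrome nonzeroPts (unit a) ≡ pt a
syndrome-unit = from-yes (all? λ a → ≡-dec _≟ᵇ_ (syndrome nonzeroPts (unit a)) (pt a))

syndrome-triple : ∀ a b c → syndrome nonzeroPts (triple a b c) ≡ pt a ⊕ (pt b ⊕ pt c)
syndrome-triple a b c =
  trans (syndrome-⊕ nonzeroPts (unit a) (unit b ⊕ unit c))
        (cong₂ _⊕_ (syndrome-unit a) (trans (syndrome-⊕ nonzeroPts (unit b) (unit c))
                                            (cong₂ _⊕_ (syndrome-unit b) (syndrome-unit c))))

P-unit : {g f : Pos → Pos} → (∀ i → f (g i) ≡ i) → (∀ j → g (f j) ≡ j) →
         ∀ a → P f (unit a) ≡ unit (g a)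
P-unit {g} {f} fg gf a = word-ext λ j → begin
  lookup (P f (unit a)) j  ≡⟨ lookup-P f (unit a) j ⟩
  lookup (unit a) (f j)    ≡⟨ lookup∘tabulate (λ k → does (k ≟ a)) (f j) ⟩
  does (f j ≟ a)           ≡⟨ does-⇔ (mk⇔ (λ fj≡a → trans (sym (gf j)) (cong g fj≡a))
                                         (λ j≡ga → trans (cong f j≡ga) (fg a)))
                                    (f j ≟ a) (j ≟ g a) ⟩
  does (j ≟ g a)           ≡⟨ lookup∘tabulate (λ k → does (k ≟ g a)) j ⟨
  lookup (unit (g a)) j    ∎
  where open ≡-Reasoning

P-triple : {g f : Pos → Pos} → (∀ i → f (g i) ≡ i) → (∀ j → g (f j) ≡ j) →
           ∀ a b c → P f (triple a b c) ≡ triple (g a) (g b) (g c)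
P-triple {g} {f} fg gf a b c =
  trans (P-⊕ f (unit a) (unit b ⊕ unit c))
        (cong₂ _⊕_ (P-unit {g} fg gf a)
                   (trans (P-⊕ f (unit b) (unit c)) (cong₂ _⊕_ (P-unit {g} fg gf b) (P-unit {g} fg gf c))))

-- A coordinate permutation f (with inverse g) under which some translate of a
-- code D ⊆ ker(syndrome) containing all line words stays inside D is linear:
-- the image of a line word is again a word of zero syndrome.
preserving⇒linear : (D : Word 15 → Set) → (∀ {u v} → D u → D v → D (u ⊕ v)) →
                    (∀ i j → ¬ i ≡ j → D (line i j)) → (∀ y → D y → syndrome nonzeroPts y ≡ 0ʷ) →
                    {g f : Pos → Pos} → (∀ i → f (g i) ≡ i) → (∀ j → g (f j) ≡ j) →
                    (x : Word 15) → D x → (∀ y → D y → D (x ⊕ P f y)) → Linear g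
preserving⇒linear D D-⊕ D-lines D⊆ker {g} {f} fg gf x Dx lift i j i≢j = begin
  g (i ⊞ j)                          ≡⟨ idx∘pt (g (i ⊞ j)) ⟨
  idx (pt (g (i ⊞ j)))               ≡⟨ cong idx (⊕-solve (pt (g i)) (pt (g j)) (pt (g (i ⊞ j))) sum≡0) ⟩
  idx (pt (g i) ⊕ pt (g j))          ∎
  where
  open ≡-Reasoning
  D-image : D (P f (line i j))
  D-image = subst D (⊕-cancelˡ x (P f (line i j))) (D-⊕ Dx (lift (line i j) (D-lines i j i≢j)))
  sum≡0 : pt (g i) ⊕ (pt (g j) ⊕ pt (g (i ⊞ j))) ≡ 0ʷ
  sum≡0 = begin
    pt (g i) ⊕ (pt (g j) ⊕ pt (g (i ⊞ j)))               ≡⟨ syndrome-triple (g i) (g j) (g (i ⊞ j)) ⟨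
    syndrome nonzeroPts (triple (g i) (g j) (g (i ⊞ j))) ≡⟨ cong (syndrome nonzeroPts) (P-triple {g} fg gf i j (i ⊞ j)) ⟨
    syndrome nonzeroPts (P f (line i j))                 ≡⟨ D⊆ker _ D-image ⟩
    0ʷ                                                   ∎

-- Extending a
-- set S of fixed points of a linear map by a fixed point b ∉ S gives the
-- fixed points  S ∪ {b} ∪ (b ⊞ S)  (for S a subspace: the subspace ⟨S, b⟩).

Fixes : List Pos → (Pos → Pos) → Set
Fixes S f = ∀ {i} → i ∈ S → f i ≡ i

extend : Pos → List Pos → List Pos
extend b S = S ++ b ∷ List.map (b ⊞_) S

fixes-extend : {f : Pos → Pos} {S : List Pos} {b : Pos} → Linear f → ¬ b ∈ S →
               Fixes S f → f b ≡ b → Fixes (extend b S) f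
fixes-extend {f} {S} {b} lin b∉S fixS fb {i} i∈ with ∈-++⁻ S i∈
... | inj₁ i∈S         = fixS i∈S
... | inj₂ (here refl) = fb
... | inj₂ (there i∈bS) with ∈-map⁻ (b ⊞_) i∈bS
...   | s , s∈S , refl = trans (lin b s b≢s) (cong₂ _⊞_ fb (fixS s∈S))
  where
  b≢s : ¬ b ≡ s
  b≢s b≡s = b∉S (subst (_∈ S) (sym b≡s) s∈S)

module Chain (C : Word 15 → Set) where

  StabiliserLiftable : List Pos → Set
  StabiliserLiftable S = ∀ f → Linear f → Injective _≡_ _≡_ f → Fixes S f → Liftable C f

  record Reducer (S : List Pos) (b p : Pos) : Set where
    field
      move      : Pos → Pos
      undo      : Pos → Pos
      linear    : Linear move
      undo-move : ∀ i → undo (move i) ≡ i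
      liftable  : Liftable C undo
      fixes     : Fixes S move
      sends     : move p ≡ b

  -- One step down the chain: if f fixes S, then f b ∉ S, and a reducer for
  -- f b turns f into  move ∘ f, which fixes  extend b S;  f itself is
  -- recovered as  undo ∘ (move ∘ f).
  chain-step : {S : List Pos} {b : Pos} → ¬ b ∈ S → (∀ p → ¬ p ∈ S → Reducer S b p) →
               StabiliserLiftable (extend b S) → StabiliserLiftable S
  chain-step {S} {b} b∉S reducer good f lin inj fixS =
    liftable-cong C (λ j → undo-move (f j))
      (liftable-∘ C {undo} {moved} liftable (good moved lin-moved inj-moved fix-moved))
    where
    fb∉S : ¬ f b ∈ S
    fb∉S fb∈S = b∉S (subst (_∈ S) (inj (fixS fb∈S)) fb∈S)
    open Reducer (reducer (f b) fb∉S)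
    moved : Pos → Pos
    moved i = move (f i)
    lin-moved : Linear moved
    lin-moved = linear-∘ {move} {f} linear lin inj
    inj-moved : Injective _≡_ _≡_ moved
    inj-moved {i} {j} eq = inj (trans (sym (undo-move (f i))) (trans (cong undo eq) (undo-move (f j))))
    fix-moved : Fixes (extend b S) moved
    fix-moved = fixes-extend {moved} lin-moved b∉S (λ s∈S → trans (cong move (fixS s∈S)) (fixes s∈S)) sends

  chain-end : {S : List Pos} → (∀ i → i ∈ S) → StabiliserLiftable S
  chain-end covers f _ _ fixS = liftable-cong C (λ j → sym (fixS (covers j))) (liftable-id C)

-- Finite facts are checked by evaluation: small ones with the library's
-- decision procedures (from-yes), the large liftability checks with the
-- Boolean word equality below, whose soundness turns evaluation into proof.

_==ʷ_ : Word n → Word n → Bool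
[]      ==ʷ []      = true
(a ∷ u) ==ʷ (b ∷ v) = not (a xor b) ∧ (u ==ʷ v)

==ʷ-sound : (u v : Word n) → T (u ==ʷ v) → u ≡ v
==ʷ-sound []          []          _  = refl
==ʷ-sound (true ∷ u)  (true ∷ v)  ok = cong (true ∷_) (==ʷ-sound u v ok)
==ʷ-sound (false ∷ u) (false ∷ v) ok = cong (false ∷_) (==ʷ-sound u v ok)

liftable-by-evaluation : (C : Code n) (f : Fin n → Fin n) (x : Word n) →
                         T (all (λ y → any (λ c → (x ⊕ P f y) ==ʷ c) C) C) → Liftable (_∈ C) f
liftable-by-evaluation C f x ok =
  x , λ y y∈C → Any.map (==ʷ-sound _ _) (any⁻ _ C (All.lookup (all⁺ _ C ok) y∈C))

-- Codewords of 𝒩 by their Kerdock parameters: the quadratic form number s,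
-- the linear part (point number a of F₂⁴) and the constant c.

KerdockIndex : Set
KerdockIndex = Fin 8 × Fin 16 × Bool

kerdockWord : Quad → Pt → Bool → Word 15
kerdockWord Q a c = Vec.map (λ v → (evalQ Q v xor dot a v) xor c) nonzeroPts

codeword : KerdockIndex → Word 15
codeword (s , a , c) = kerdockWord (List.lookup kerdockSet s) (List.lookup allPts a) c

∈-concatMap⁺′ : {A B : Set} {f : A → List B} {x : A} {xs : List A} {y : B} →
               x ∈ xs → y ∈ f x → y ∈ List.concatMap f xs
∈-concatMap⁺′ {f = f} x∈xs y∈fx = ∈-concat⁺′ y∈fx (∈-map⁺ f x∈xs)

∈-bools : ∀ c → c ∈ false ∷ true ∷ []
∈-bools false = here refl
∈-bools true  = there (here refl)

kerdockWords : Quad → List (Word 15)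
kerdockWords Q = List.concatMap (λ a → List.map (kerdockWord Q a) (false ∷ true ∷ [])) allPts

codeword-∈ : ∀ k → 𝒩 (codeword k)
codeword-∈ (s , a , c) =
  ∈-concatMap⁺′ {f = kerdockWords} (∈-lookup {xs = kerdockSet} s)
    (∈-concatMap⁺′ {f = λ a → List.map (kerdockWord Q a) (false ∷ true ∷ [])} (∈-lookup {xs = allPts} a)
      (∈-map⁺ (kerdockWord Q (List.lookup allPts a)) (∈-bools c)))
  where
  Q : Quad
  Q = List.lookup kerdockSet s

0∈𝒩 : 𝒩 0ʷ
0∈𝒩 = codeword-∈ (# 0 , # 0 , false)

ℋ⊆ker : ∀ y → ℋ₁₅ y → syndrome nonzeroPts y ≡ 0ʷ
ℋ⊆ker = syndrome-span nonzeroPts (λ c c∈𝒩 → All.lookup 𝒩⊆ker c∈𝒩)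
  where
  𝒩⊆ker : All (λ c → syndrome nonzeroPts c ≡ 0ʷ) puncturedNR
  𝒩⊆ker = from-yes (All.all? (λ c → ≡-dec _≟ᵇ_ (syndrome nonzeroPts c) 0ʷ) puncturedNR)

-- Every line word is a sum of three codewords of 𝒩 (one certificate per
-- line of PG(3,2)); hence ℋ₁₅ contains all line words.

sum₃ : KerdockIndex × KerdockIndex × KerdockIndex → Word 15
sum₃ (k , l , m) = codeword k ⊕ (codeword l ⊕ codeword m)

sum₃-∈ℋ : ∀ t → ℋ₁₅ (sum₃ t)
sum₃-∈ℋ (k , l , m) =
  codeword k ∷ codeword l ∷ codeword m ∷ [] ,
  codeword-∈ k ∷ codeword-∈ l ∷ codeword-∈ m ∷ [] ,
  cong (λ w → codeword k ⊕ (codeword l ⊕ w)) (⊕-identityʳ (codeword m))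

lineCertificates : List (KerdockIndex × KerdockIndex × KerdockIndex)
lineCertificates =
  ((# 2 , # 0 , false) , (# 4 , # 12 , true) , (# 5 , # 0 , false)) ∷
  ((# 1 , # 0 , false) , (# 3 , # 10 , true) , (# 4 , # 0 , false)) ∷
  ((# 4 , # 0 , false) , (# 6 , # 14 , true) , (# 7 , # 0 , false)) ∷
  ((# 1 , # 0 , false) , (# 2 , # 6 , true) , (# 7 , # 0 , false)) ∷
  ((# 2 , # 0 , false) , (# 3 , # 14 , true) , (# 6 , # 0 , false)) ∷
  ((# 1 , # 0 , false) , (# 5 , # 14 , true) , (# 6 , # 0 , false)) ∷
  ((# 3 , # 0 , false) , (# 5 , # 14 , true) , (# 7 , # 0 , false)) ∷
  ((# 1 , # 0 , false) , (# 2 , # 9 , true) , (# 6 , # 0 , false)) ∷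
  ((# 2 , # 0 , false) , (# 3 , # 13 , true) , (# 7 , # 0 , false)) ∷
  ((# 1 , # 0 , false) , (# 3 , # 5 , true) , (# 5 , # 0 , false)) ∷
  ((# 5 , # 0 , false) , (# 6 , # 13 , true) , (# 7 , # 0 , false)) ∷
  ((# 1 , # 0 , false) , (# 4 , # 13 , true) , (# 7 , # 0 , false)) ∷
  ((# 3 , # 0 , false) , (# 4 , # 13 , true) , (# 6 , # 0 , false)) ∷
  ((# 1 , # 0 , false) , (# 5 , # 11 , true) , (# 7 , # 0 , false)) ∷
  ((# 3 , # 0 , false) , (# 5 , # 15 , true) , (# 6 , # 0 , false)) ∷
  ((# 1 , # 0 , false) , (# 4 , # 7 , true) , (# 6 , # 0 , false)) ∷
  ((# 3 , # 0 , false) , (# 4 , # 15 , true) , (# 7 , # 0 , false)) ∷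
  ((# 1 , # 0 , false) , (# 2 , # 15 , true) , (# 3 , # 0 , false)) ∷
  ((# 2 , # 0 , false) , (# 6 , # 15 , true) , (# 7 , # 0 , false)) ∷
  ((# 3 , # 0 , false) , (# 6 , # 3 , true) , (# 7 , # 0 , false)) ∷
  ((# 2 , # 0 , false) , (# 3 , # 11 , true) , (# 5 , # 0 , false)) ∷
  ((# 4 , # 0 , false) , (# 5 , # 11 , true) , (# 6 , # 0 , false)) ∷
  ((# 2 , # 0 , false) , (# 4 , # 11 , true) , (# 7 , # 0 , false)) ∷
  ((# 4 , # 0 , false) , (# 5 , # 7 , true) , (# 7 , # 0 , false)) ∷
  ((# 2 , # 0 , false) , (# 4 , # 15 , true) , (# 6 , # 0 , false)) ∷
  ((# 1 , # 0 , false) , (# 6 , # 15 , true) , (# 7 , # 0 , false)) ∷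
  ((# 1 , # 0 , false) , (# 2 , # 15 , true) , (# 5 , # 0 , false)) ∷
  ((# 2 , # 0 , false) , (# 3 , # 7 , true) , (# 4 , # 0 , false)) ∷
  ((# 1 , # 0 , false) , (# 4 , # 15 , true) , (# 5 , # 0 , false)) ∷
  ((# 2 , # 0 , false) , (# 5 , # 15 , true) , (# 7 , # 0 , false)) ∷
  ((# 1 , # 0 , false) , (# 3 , # 15 , true) , (# 7 , # 0 , false)) ∷
  ((# 2 , # 0 , false) , (# 5 , # 7 , true) , (# 6 , # 0 , false)) ∷
  ((# 1 , # 0 , false) , (# 3 , # 15 , true) , (# 6 , # 0 , false)) ∷
  ((# 1 , # 0 , false) , (# 2 , # 15 , true) , (# 4 , # 0 , false)) ∷
  ((# 3 , # 0 , false) , (# 4 , # 15 , true) , (# 5 , # 0 , false)) ∷ []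

lines-certified : ∀ i j → ¬ i ≡ j → Any (λ t → sum₃ t ≡ line i j) lineCertificates
lines-certified =
  from-yes (all? λ i → all? λ j → ¬? (i ≟ j) →-dec any? (λ t → ≡-dec _≟ᵇ_ (sum₃ t) (line i j)) lineCertificates)

lines-∈ℋ : ∀ i j → ¬ i ≡ j → ℋ₁₅ (line i j)
lines-∈ℋ i j i≢j = certified⇒ℋ (lines-certified i j i≢j)
  where
  certified⇒ℋ : ∀ {w ts} → Any (λ t → sum₃ t ≡ w) ts → ℋ₁₅ w
  certified⇒ℋ {ts = t ∷ _} (here sum≡w) = subst ℋ₁₅ sum≡w (sum₃-∈ℋ t)
  certified⇒ℋ (there any)                = certified⇒ℋ any

-- Two coordinate permutations generating GL(4,2) (this is a consequence of
-- the chain below).  𝐚 has order 6 and 𝐛 order 7; each extends to an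
-- automorphism of 𝒩 with translation part  shift c.

data Gen : Set where
  𝐚 𝐛 : Gen

gen : Gen → Pos → Pos
gen 𝐚 j = lookup (# 2 ∷ # 9 ∷ # 8 ∷ # 12 ∷ # 13 ∷ # 6 ∷ # 3 ∷ # 1 ∷ # 0 ∷ # 7 ∷ # 10 ∷ # 14 ∷ # 11 ∷ # 4 ∷ # 5 ∷ []) j
gen 𝐛 j = lookup (# 1 ∷ # 7 ∷ # 9 ∷ # 0 ∷ # 2 ∷ # 8 ∷ # 10 ∷ # 6 ∷ # 4 ∷ # 14 ∷ # 12 ∷ # 5 ∷ # 3 ∷ # 13 ∷ # 11 ∷ []) j

shift : Gen → KerdockIndex
shift 𝐚 = # 4 , # 0 , false
shift 𝐛 = # 1 , # 0 , false

gen-linear : ∀ c → Linear (gen c)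
gen-linear 𝐚 = from-yes (all? λ i → all? λ j → ¬? (i ≟ j) →-dec (gen 𝐚 (i ⊞ j) ≟ gen 𝐚 i ⊞ gen 𝐚 j))
gen-linear 𝐛 = from-yes (all? λ i → all? λ j → ¬? (i ≟ j) →-dec (gen 𝐛 (i ⊞ j) ≟ gen 𝐛 i ⊞ gen 𝐛 j))

gen-liftable : ∀ c → Liftable 𝒩 (gen c)
gen-liftable 𝐚 = liftable-by-evaluation puncturedNR (gen 𝐚) (codeword (shift 𝐚)) (Equivalence.from T-≡ refl)
gen-liftable 𝐛 = liftable-by-evaluation puncturedNR (gen 𝐛) (codeword (shift 𝐛)) (Equivalence.from T-≡ refl)

-- Words in the generators, read as compositions (rightmost letter first).

⟦_⟧ : List Gen → Pos → Pos
⟦ [] ⟧    j = j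
⟦ c ∷ w ⟧ j = gen c (⟦ w ⟧ j)

⟦⟧-++ : ∀ u v j → ⟦ u ++ v ⟧ j ≡ ⟦ u ⟧ (⟦ v ⟧ j)
⟦⟧-++ []      v j = refl
⟦⟧-++ (c ∷ u) v j = cong (gen c) (⟦⟧-++ u v j)

-- Inverses are positive words, since the generators have finite order.
gen⁻¹ : Gen → List Gen
gen⁻¹ 𝐚 = List.replicate 5 𝐚
gen⁻¹ 𝐛 = List.replicate 6 𝐛

gen⁻¹-gen : ∀ c j → ⟦ gen⁻¹ c ⟧ (gen c j) ≡ j
gen⁻¹-gen 𝐚 = from-yes (all? λ j → ⟦ gen⁻¹ 𝐚 ⟧ (gen 𝐚 j) ≟ j)
gen⁻¹-gen 𝐛 = from-yes (all? λ j → ⟦ gen⁻¹ 𝐛 ⟧ (gen 𝐛 j) ≟ j)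

_⁻¹ : List Gen → List Gen
[] ⁻¹      = []
(c ∷ w) ⁻¹ = w ⁻¹ ++ gen⁻¹ c

⁻¹-cancel : ∀ w j → ⟦ w ⁻¹ ⟧ (⟦ w ⟧ j) ≡ j
⁻¹-cancel []      j = refl
⁻¹-cancel (c ∷ w) j = begin
  ⟦ w ⁻¹ ++ gen⁻¹ c ⟧ (gen c (⟦ w ⟧ j))        ≡⟨ ⟦⟧-++ (w ⁻¹) (gen⁻¹ c) (gen c (⟦ w ⟧ j)) ⟩
  ⟦ w ⁻¹ ⟧ (⟦ gen⁻¹ c ⟧ (gen c (⟦ w ⟧ j)))      ≡⟨ cong ⟦ w ⁻¹ ⟧ (gen⁻¹-gen c (⟦ w ⟧ j)) ⟩
  ⟦ w ⁻¹ ⟧ (⟦ w ⟧ j)                            ≡⟨ ⁻¹-cancel w j ⟩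
  j                                             ∎
  where open ≡-Reasoning

word-linear : ∀ w → Linear ⟦ w ⟧
word-linear []      i j _ = refl
word-linear (c ∷ w) =
  linear-∘ {gen c} {⟦ w ⟧} (gen-linear c) (word-linear w) (retraction⇒injective {g = ⟦ w ⁻¹ ⟧} (⁻¹-cancel w))

word-liftable : ∀ w → Liftable 𝒩 ⟦ w ⟧
word-liftable []      = liftable-id 𝒩
word-liftable (c ∷ w) = liftable-∘ 𝒩 {gen c} {⟦ w ⟧} (gen-liftable c) (word-liftable w)

-- The chain  ∅ = V₀ ⊂ V₁ ⊂ V₂ ⊂ V₃ ⊂ V₄ = PG(3,2)  of spans of the basis
-- points b₀ = 0001, b₁ = 0010, b₂ = 0100, b₃ = 1000 (positions 0, 1, 3, 7).

open Chain 𝒩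

V₀ V₁ V₂ V₃ V₄ : List Pos
V₀ = []
V₁ = extend (# 0) V₀
V₂ = extend (# 1) V₁
V₃ = extend (# 3) V₂
V₄ = extend (# 7) V₃

Transversal : List Pos → Pos → Vec (List Gen) 15 → Set
Transversal S b T = ¬ b ∈ S × (∀ p → ¬ p ∈ S → All (λ i → ⟦ lookup T p ⟧ i ≡ i) S × ⟦ lookup T p ⟧ p ≡ b)

transversal? : ∀ S b T → Dec (Transversal S b T)
transversal? S b T =
  ¬? (b ∈? S) ×-dec
  all? λ p → ¬? (p ∈? S) →-dec (All.all? (λ i → ⟦ lookup T p ⟧ i ≟ i) S ×-dec (⟦ lookup T p ⟧ p ≟ b))

stage : ∀ S b T → True (transversal? S b T) → StabiliserLiftable (extend b S) → StabiliserLiftable S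
stage S b T ok = chain-step b∉S reducer
  where
  certified : Transversal S b T
  certified = toWitness {a? = transversal? S b T} ok
  b∉S : ¬ b ∈ S
  b∉S = proj₁ certified
  words : ∀ p → ¬ p ∈ S → All (λ i → ⟦ lookup T p ⟧ i ≡ i) S × ⟦ lookup T p ⟧ p ≡ b
  words = proj₂ certified
  reducer : ∀ p → ¬ p ∈ S → Reducer S b p
  reducer p p∉S = record
    { move      = ⟦ w ⟧
    ; undo      = ⟦ w ⁻¹ ⟧
    ; linear    = word-linear w
    ; undo-move = ⁻¹-cancel w
    ; liftable  = word-liftable (w ⁻¹)
    ; fixes     = All.lookup (proj₁ (words p p∉S))
    ; sends     = proj₂ (words p p∉S)
    }
    where
    w : List Gen
    w = lookup T p

-- Transversals of the four steps (entries at points of Vₖ are unused).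
T₀ : Vec (List Gen) 15
T₀ =
  [] ∷
  (𝐛 ∷ 𝐚 ∷ 𝐛 ∷ 𝐛 ∷ []) ∷
  (𝐚 ∷ 𝐚 ∷ []) ∷
  (𝐛 ∷ []) ∷
  (𝐚 ∷ 𝐚 ∷ 𝐛 ∷ []) ∷
  (𝐚 ∷ 𝐛 ∷ []) ∷
  (𝐛 ∷ 𝐚 ∷ []) ∷
  (𝐛 ∷ 𝐚 ∷ 𝐛 ∷ []) ∷
  (𝐚 ∷ []) ∷
  (𝐛 ∷ 𝐚 ∷ 𝐛 ∷ 𝐚 ∷ []) ∷
  (𝐛 ∷ 𝐛 ∷ 𝐛 ∷ []) ∷
  (𝐚 ∷ 𝐛 ∷ 𝐛 ∷ []) ∷
  (𝐛 ∷ 𝐛 ∷ []) ∷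
  (𝐚 ∷ 𝐚 ∷ 𝐛 ∷ 𝐚 ∷ []) ∷
  (𝐚 ∷ 𝐛 ∷ 𝐚 ∷ []) ∷ []

T₁ : Vec (List Gen) 15
T₁ =
  [] ∷
  [] ∷
  (𝐚 ∷ 𝐛 ∷ 𝐚 ∷ 𝐚 ∷ 𝐛 ∷ 𝐛 ∷ 𝐛 ∷ 𝐚 ∷ []) ∷
  (𝐛 ∷ 𝐚 ∷ 𝐚 ∷ 𝐚 ∷ 𝐛 ∷ 𝐛 ∷ 𝐚 ∷ []) ∷
  (𝐚 ∷ 𝐚 ∷ 𝐛 ∷ 𝐛 ∷ 𝐚 ∷ 𝐚 ∷ []) ∷
  (𝐛 ∷ 𝐛 ∷ 𝐛 ∷ 𝐚 ∷ 𝐛 ∷ 𝐛 ∷ 𝐚 ∷ 𝐛 ∷ 𝐚 ∷ []) ∷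
  (𝐛 ∷ 𝐚 ∷ 𝐛 ∷ 𝐛 ∷ 𝐚 ∷ 𝐛 ∷ 𝐛 ∷ []) ∷
  (𝐛 ∷ 𝐚 ∷ 𝐚 ∷ 𝐚 ∷ 𝐛 ∷ 𝐚 ∷ 𝐛 ∷ []) ∷
  (𝐚 ∷ 𝐛 ∷ 𝐚 ∷ 𝐛 ∷ 𝐛 ∷ 𝐚 ∷ []) ∷
  (𝐛 ∷ 𝐛 ∷ 𝐚 ∷ 𝐚 ∷ 𝐛 ∷ 𝐛 ∷ 𝐛 ∷ []) ∷
  (𝐚 ∷ 𝐛 ∷ 𝐛 ∷ 𝐛 ∷ 𝐛 ∷ 𝐛 ∷ 𝐚 ∷ []) ∷
  (𝐚 ∷ 𝐚 ∷ 𝐛 ∷ 𝐚 ∷ 𝐚 ∷ 𝐛 ∷ 𝐚 ∷ 𝐚 ∷ []) ∷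
  (𝐚 ∷ 𝐛 ∷ 𝐛 ∷ 𝐛 ∷ 𝐛 ∷ 𝐚 ∷ 𝐛 ∷ []) ∷
  (𝐚 ∷ 𝐛 ∷ 𝐚 ∷ 𝐚 ∷ 𝐛 ∷ 𝐛 ∷ 𝐚 ∷ 𝐛 ∷ []) ∷
  (𝐛 ∷ 𝐚 ∷ 𝐛 ∷ 𝐛 ∷ 𝐛 ∷ []) ∷ []

T₂ : Vec (List Gen) 15
T₂ =
  [] ∷
  [] ∷
  [] ∷
  [] ∷
  (𝐛 ∷ 𝐛 ∷ 𝐛 ∷ 𝐛 ∷ 𝐚 ∷ 𝐛 ∷ 𝐛 ∷ 𝐛 ∷ 𝐚 ∷ 𝐛 ∷ []) ∷
  (𝐛 ∷ 𝐚 ∷ 𝐛 ∷ 𝐛 ∷ 𝐚 ∷ 𝐚 ∷ 𝐚 ∷ 𝐚 ∷ 𝐚 ∷ 𝐛 ∷ 𝐚 ∷ []) ∷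
  (𝐛 ∷ 𝐚 ∷ 𝐚 ∷ 𝐚 ∷ 𝐚 ∷ 𝐚 ∷ 𝐛 ∷ 𝐛 ∷ 𝐛 ∷ 𝐚 ∷ 𝐛 ∷ 𝐚 ∷ []) ∷
  (𝐛 ∷ 𝐛 ∷ 𝐚 ∷ 𝐚 ∷ 𝐛 ∷ 𝐚 ∷ 𝐛 ∷ 𝐛 ∷ 𝐛 ∷ 𝐚 ∷ 𝐚 ∷ []) ∷
  (𝐛 ∷ 𝐛 ∷ 𝐛 ∷ 𝐚 ∷ 𝐛 ∷ 𝐚 ∷ 𝐚 ∷ 𝐚 ∷ 𝐛 ∷ 𝐛 ∷ 𝐛 ∷ 𝐚 ∷ []) ∷
  (𝐛 ∷ 𝐛 ∷ 𝐚 ∷ 𝐚 ∷ 𝐚 ∷ 𝐚 ∷ 𝐛 ∷ 𝐛 ∷ 𝐚 ∷ []) ∷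
  (𝐚 ∷ 𝐛 ∷ 𝐛 ∷ 𝐛 ∷ 𝐚 ∷ 𝐛 ∷ 𝐛 ∷ 𝐚 ∷ 𝐛 ∷ []) ∷
  (𝐚 ∷ 𝐛 ∷ 𝐛 ∷ 𝐛 ∷ 𝐚 ∷ 𝐛 ∷ 𝐛 ∷ 𝐚 ∷ 𝐚 ∷ 𝐚 ∷ 𝐚 ∷ 𝐛 ∷ []) ∷
  (𝐛 ∷ 𝐛 ∷ 𝐚 ∷ 𝐛 ∷ 𝐚 ∷ 𝐚 ∷ 𝐛 ∷ 𝐛 ∷ 𝐚 ∷ 𝐛 ∷ 𝐛 ∷ []) ∷
  (𝐛 ∷ 𝐚 ∷ 𝐛 ∷ 𝐛 ∷ 𝐛 ∷ 𝐛 ∷ 𝐚 ∷ 𝐛 ∷ 𝐛 ∷ 𝐚 ∷ 𝐛 ∷ 𝐛 ∷ []) ∷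
  (𝐚 ∷ 𝐚 ∷ 𝐚 ∷ []) ∷ []

T₃ : Vec (List Gen) 15
T₃ =
  [] ∷
  [] ∷
  [] ∷
  [] ∷
  [] ∷
  [] ∷
  [] ∷
  [] ∷
  (𝐛 ∷ 𝐚 ∷ 𝐚 ∷ 𝐚 ∷ 𝐛 ∷ 𝐛 ∷ 𝐚 ∷ 𝐛 ∷ 𝐛 ∷ 𝐚 ∷ 𝐚 ∷ 𝐛 ∷ 𝐛 ∷ 𝐛 ∷ []) ∷
  (𝐚 ∷ 𝐛 ∷ 𝐛 ∷ 𝐛 ∷ 𝐛 ∷ 𝐚 ∷ 𝐚 ∷ 𝐛 ∷ 𝐛 ∷ 𝐚 ∷ 𝐚 ∷ 𝐚 ∷ []) ∷
  (𝐚 ∷ 𝐛 ∷ 𝐛 ∷ 𝐛 ∷ 𝐛 ∷ 𝐚 ∷ 𝐛 ∷ 𝐛 ∷ 𝐚 ∷ 𝐛 ∷ 𝐛 ∷ 𝐛 ∷ []) ∷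
  (𝐚 ∷ 𝐛 ∷ 𝐛 ∷ 𝐚 ∷ 𝐚 ∷ 𝐚 ∷ 𝐚 ∷ 𝐛 ∷ 𝐛 ∷ 𝐛 ∷ 𝐛 ∷ 𝐚 ∷ []) ∷
  (𝐚 ∷ 𝐚 ∷ 𝐚 ∷ 𝐛 ∷ 𝐛 ∷ 𝐚 ∷ 𝐚 ∷ 𝐚 ∷ 𝐚 ∷ 𝐛 ∷ 𝐛 ∷ 𝐚 ∷ []) ∷
  (𝐛 ∷ 𝐛 ∷ 𝐚 ∷ 𝐛 ∷ 𝐛 ∷ 𝐛 ∷ 𝐚 ∷ 𝐛 ∷ 𝐛 ∷ 𝐛 ∷ 𝐛 ∷ 𝐚 ∷ []) ∷
  (𝐚 ∷ 𝐛 ∷ 𝐚 ∷ 𝐛 ∷ 𝐚 ∷ 𝐚 ∷ 𝐚 ∷ 𝐚 ∷ 𝐛 ∷ []) ∷ []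

linear⇒liftable : StabiliserLiftable V₀
linear⇒liftable =
  stage V₀ (# 0) T₀ _ (
  stage V₁ (# 1) T₁ _ (
  stage V₂ (# 3) T₂ _ (
  stage V₃ (# 7) T₃ _ (
  chain-end (from-yes (all? (λ (i : Pos) → i ∈? V₄)))))))

-- Π_{Aut ℋ₁₅} ⊆ Π_{Aut 𝒩}: a permutation part of Aut(ℋ₁₅) is linear, and
-- linear permutations and their inverses are liftable for 𝒩.
ΠAut-ℋ⊆ΠAut-𝒩 : ∀ π → InΠAut ℋ₁₅ π → InΠAut 𝒩 π
ΠAut-ℋ⊆ΠAut-𝒩 π (x , x∈ℋ , forth , _) =
  liftable⇒InΠAut 𝒩 π 0∈𝒩 (linear⇒liftable (π ⟨$⟩ˡ_) lin-ˡ inj-ˡ (λ ()))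
                           (linear⇒liftable (π ⟨$⟩ʳ_) lin-ʳ inj-ʳ (λ ()))
  where
  lin-ʳ : Linear (π ⟨$⟩ʳ_)
  lin-ʳ = preserving⇒linear ℋ₁₅ span-⊕ lines-∈ℋ ℋ⊆ker {π ⟨$⟩ʳ_} {π ⟨$⟩ˡ_}
                             (λ i → inverseˡ π) (λ j → inverseʳ π) x x∈ℋ forth
  lin-ˡ : Linear (π ⟨$⟩ˡ_)
  lin-ˡ = linear-inverse {π ⟨$⟩ʳ_} {π ⟨$⟩ˡ_} (λ i → inverseˡ π) (λ j → inverseʳ π) lin-ʳ
  inj-ˡ : Injective _≡_ _≡_ (π ⟨$⟩ˡ_)
  inj-ˡ = retraction⇒injective {g = π ⟨$⟩ʳ_} (λ j → inverseʳ π)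
  inj-ʳ : Injective _≡_ _≡_ (π ⟨$⟩ʳ_)
  inj-ʳ = retraction⇒injective {g = π ⟨$⟩ˡ_} (λ i → inverseˡ π)

corollary1 : NarrowSenseEmbedded 𝒩 ℋ₁₅
corollary1 = aut-𝒩⊆aut-ℋ , (λ π (x , aut) → x , aut-𝒩⊆aut-ℋ x π aut) , ΠAut-ℋ⊆ΠAut-𝒩
  where
  aut-𝒩⊆aut-ℋ : ∀ x π → InAut 𝒩 x π → InAut ℋ₁₅ x π
  aut-𝒩⊆aut-ℋ = aut-span puncturedNR 0∈𝒩
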